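{- Let $n=2m+1$ be an odd integer and let $A=[a_{ij}]$ be an extreme point of $\Omega_n^{t\&h}$ with $a_{m+1,m+1}=0$. Then one of the following holds: (a) there exists an integer $k$ with $1\le k\le m$ such that $a_{k,m+1}=a_{m+1,k}=a_{m+1,2m+2-k}=a_{2m+2-k,m+1}=\frac12$; (b) there exist integers $k,l$ with $1\le k<l\le m$ such that $a_{k,m+1}=a_{m+1,k}=a_{m+1,2m+2-k}=a_{2m+2-k,m+1}=\frac14$ and $a_{l,m+1}=a_{m+1,l}=a_{m+1,2m+2-l}=a_{2m+2-l,m+1}=\frac14$. In both cases, all other entries in row $m+1$ and column $m+1$ of $A$ equal zero.
   Context: For an $n\times n$ matrix $A=[a_{ij}]$, $A^t$ is the transpose and the Hankel transpose $A^h$ has $(i,j)$ entry $a_{n+1-j,n+1-i}$; $A$ is Hankel-symmetric if $A^h=A$. $\Omega_n^{t\&h}$ is the convex polytope of all $n\times n$ doubly stochastic matrices (nonnegative, all row and column sums $1$) that are both symmetric and Hankel-symmetric.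
   Formalization: The polytope $\Omega_n^{t\&h}$ is taken over ℚ: $A$, and the matrices and weights of the convex combinations that test extremeness, have rational entries. -}

module Defs where

open import Data.Nat using (ℕ; zero; suc; _+_; s≤s)
open import Data.Nat.Properties using (m≤m+n)
open import Data.Fin using (Fin; zero; suc; opposite; fromℕ<)
open import Data.Rational using (ℚ; 0ℚ; 1ℚ; ½; _≤_; _<_; _-_) renaming (_+_ to _+ℚ_; _*_ to _*ℚ_)
open import Data.Product using (_×_)
open import Relation.Binary.PropositionalEquality using (_≡_)

Matrix : ℕ → Set
Matrix n = Fin n → Fin n → ℚ

sumFin : ∀ n → (Fin n → ℚ) → ℚ
sumFin zero    f = 0ℚ
sumFin (suc n) f = f zero +ℚ sumFin n (λ i → f (suc i))

-- transpose and Hankel transpose: (A^h)_{ij} = a_{n+1-j, n+1-i}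
transpose : ∀ {n} → Matrix n → Matrix n
transpose A i j = A j i

hankelTranspose : ∀ {n} → Matrix n → Matrix n
hankelTranspose A i j = A (opposite j) (opposite i)

_≋_ : ∀ {n} → Matrix n → Matrix n → Set
A ≋ B = ∀ i j → A i j ≡ B i j

DoublyStochastic : ∀ {n} → Matrix n → Set
DoublyStochastic {n} A =
  (∀ i j → 0ℚ ≤ A i j) ×
  (∀ i → sumFin n (λ j → A i j) ≡ 1ℚ) ×
  (∀ j → sumFin n (λ i → A i j) ≡ 1ℚ)

InΩth : ∀ {n} → Matrix n → Set
InΩth A = DoublyStochastic A × (transpose A ≋ A) × (hankelTranspose A ≋ A)

combo : ∀ {n} → ℚ → Matrix n → Matrix n → Matrix n
combo t B C i j = (t *ℚ B i j) +ℚ ((1ℚ - t) *ℚ C i j)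

IsExtreme : ∀ {n} → (Matrix n → Set) → Matrix n → Set
IsExtreme {n} S A =
  S A ×
  (∀ (B C : Matrix n) (t : ℚ) → S B → S C → 0ℚ < t → t < 1ℚ →
     A ≋ combo t B C → B ≋ C)

-- the middle index m+1 (0-based: m) of Fin (2m+1)
mid : (m : ℕ) → Fin (suc (m + m))
mid m = fromℕ< (s≤s (m≤m+n m m))

¼ : ℚ
¼ = ½ *ℚ ½

{-# OPTIONS --safe #-}
module Submission where

-- An extreme point A of Ω^{t&h} is doubly stochastic, so by Hall's marriage theorem (applied to
-- the support of A) the support contains a permutation matrix P.  The symmetrization
-- B = ¼ (P + Pᵗ + Pʰ + Pᵗʰ) lies in Ω^{t&h}, and εB ≤ A entrywise for some ε > 0; hence
-- A ± ε(B − A) both lie in Ω^{t&h} and extremality forces A = B.  The middle index c = m+1 is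
-- fixed by the reflection x ↦ x′ = n+1−x, so row c of B is ¼ (e_{πc} + e_{(πc)′} + e_{π⁻¹c} + e_{(π⁻¹c)′}).
-- As a_cc = 0, neither πc nor π⁻¹c is c, so {πc, (πc)′} and {π⁻¹c, (π⁻¹c)′} are pairs of distinct
-- indices; the two cases of the theorem are whether these pairs coincide or not.

open import Defs

module Hall where

  open import Data.Empty using (⊥; ⊥-elim)
  open import Data.Fin using (Fin; zero; suc; _≟_)
  open import Data.Fin.Properties using (any?)
  open import Data.Fin.Subset
    using (Subset; inside; outside; _∈_; _∉_; _⊆_; _∪_; _∩_; _─_; _-_; ⁅_⁆; ∣_∣; Nonempty)
    renaming (⊥ to ∅)
  open import Data.Fin.Subset.Properties
    using (_∈?_; ∉⊥; x∈⁅x⁆; x∈⁅y⁆⇒x≡y; ∣⁅x⁆∣≡1; ∣⊥∣≡0; x∈p∪q⁺; x∈p∪q⁻; x∈p∩q⁺; x∈p∩q⁻; p─q⊆p;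
           x∈p∧x≢y⇒x∈p-y; x∈p⇒∣p-x∣<∣p∣; p⊆q⇒∣p∣≤∣q∣; nonempty?; Empty-unique; anySubset?)
  open import Data.Nat using (ℕ; zero; suc; _+_; _≤_; _<_; z≤n; s≤s; _≤?_)
  open import Data.Nat.Induction using (<-wellFounded)
  open import Data.Nat.Properties
    using (≤-trans; ≤-reflexive; m≤m+n; +-suc; +-mono-≤; +-monoʳ-≤; +-mono-<-≤; +-mono-≤-<;
           ≮⇒≥; <⇒≱; 1+n≰n; module ≤-Reasoning)
  open import Data.Product using (Σ; ∃; ∃₂; _×_; _,_; proj₁; proj₂)
  open import Data.Sum using (_⊎_; inj₁; inj₂)
  open import Data.Vec using ([]; _∷_; here; there)
  open import Function using (_∘_)
  open import Function.Definitions using (Injective)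
  open import Induction.WellFounded using (module All)
  import Relation.Binary.Construct.On as On
  open import Relation.Binary.PropositionalEquality using (_≡_; _≢_; refl; sym; trans; cong; subst)
  open import Relation.Nullary using (¬_; Dec; yes; no; ¬?; contradiction)
  open import Relation.Nullary.Decidable using (_×-dec_)

  private
    variable
      k n : ℕ
      p : Subset n
      x y : Fin n

  x∈p─q⇒x∉q : ∀ {q} → x ∈ p ─ q → x ∉ q
  x∈p─q⇒x∉q {p = _ ∷ _} {outside ∷ _} here        ()
  x∈p─q⇒x∉q {p = _ ∷ _} {_ ∷ _}       (there x∈p─q) (there x∈q) = x∈p─q⇒x∉q x∈p─q x∈q

  x∈p-y⇒x≢y : x ∈ p - y → x ≢ y
  x∈p-y⇒x≢y {y = y} x∈p-y refl = x∈p─q⇒x∉q x∈p-y (x∈⁅x⁆ y)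

  x∈p⇒1≤∣p∣ : x ∈ p → 1 ≤ ∣ p ∣
  x∈p⇒1≤∣p∣ x∈p = ≤-trans (s≤s z≤n) (x∈p⇒∣p-x∣<∣p∣ x∈p)

  x∈p∧y∈p∧x≢y⇒2≤∣p∣ : x ∈ p → y ∈ p → x ≢ y → 2 ≤ ∣ p ∣
  x∈p∧y∈p∧x≢y⇒2≤∣p∣ x∈p y∈p x≢y =
    ≤-trans (s≤s (x∈p⇒1≤∣p∣ (x∈p∧x≢y⇒x∈p-y y∈p (x≢y ∘ sym)))) (x∈p⇒∣p-x∣<∣p∣ x∈p)

  1≤∣p∣⇒Nonempty : ∀ {n} {p : Subset n} → 1 ≤ ∣ p ∣ → Nonempty p
  1≤∣p∣⇒Nonempty {n} {p} 1≤∣p∣ with nonempty? p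
  ... | yes nonempty = nonempty
  ... | no  empty    =
    contradiction (subst (1 ≤_) (trans (cong ∣_∣ (Empty-unique empty)) (∣⊥∣≡0 n)) 1≤∣p∣) λ ()

  ∣p∪q∣+∣p∩q∣≡∣p∣+∣q∣ : ∀ (p q : Subset n) → ∣ p ∪ q ∣ + ∣ p ∩ q ∣ ≡ ∣ p ∣ + ∣ q ∣
  ∣p∪q∣+∣p∩q∣≡∣p∣+∣q∣ []            []            = refl
  ∣p∪q∣+∣p∩q∣≡∣p∣+∣q∣ (inside  ∷ p) (inside  ∷ q) =
    cong suc (trans (+-suc _ _) (trans (cong suc (∣p∪q∣+∣p∩q∣≡∣p∣+∣q∣ p q)) (sym (+-suc _ _))))
  ∣p∪q∣+∣p∩q∣≡∣p∣+∣q∣ (inside  ∷ p) (outside ∷ q) = cong suc (∣p∪q∣+∣p∩q∣≡∣p∣+∣q∣ p q)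
  ∣p∪q∣+∣p∩q∣≡∣p∣+∣q∣ (outside ∷ p) (inside  ∷ q) =
    trans (cong suc (∣p∪q∣+∣p∩q∣≡∣p∣+∣q∣ p q)) (sym (+-suc _ _))
  ∣p∪q∣+∣p∩q∣≡∣p∣+∣q∣ (outside ∷ p) (outside ∷ q) = ∣p∪q∣+∣p∩q∣≡∣p∣+∣q∣ p q

  ∣p∪q∣≤∣p∣+∣q∣ : ∀ (p q : Subset n) → ∣ p ∪ q ∣ ≤ ∣ p ∣ + ∣ q ∣
  ∣p∪q∣≤∣p∣+∣q∣ p q = ≤-trans (m≤m+n _ _) (≤-reflexive (∣p∪q∣+∣p∩q∣≡∣p∣+∣q∣ p q))

  ∣p∣≤1+∣p-x∣ : ∀ (p : Subset n) x → ∣ p ∣ ≤ suc ∣ p - x ∣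
  ∣p∣≤1+∣p-x∣ p x = begin
    ∣ p ∣                 ≤⟨ p⊆q⇒∣p∣≤∣q∣ p⊆⁅x⁆∪p-x ⟩
    ∣ ⁅ x ⁆ ∪ (p - x) ∣   ≤⟨ ∣p∪q∣≤∣p∣+∣q∣ ⁅ x ⁆ (p - x) ⟩
    ∣ ⁅ x ⁆ ∣ + ∣ p - x ∣ ≡⟨ cong (_+ ∣ p - x ∣) (∣⁅x⁆∣≡1 x) ⟩
    suc ∣ p - x ∣         ∎
    where
    open ≤-Reasoning
    p⊆⁅x⁆∪p-x : p ⊆ ⁅ x ⁆ ∪ (p - x)
    p⊆⁅x⁆∪p-x {y} y∈p with y ≟ x
    ... | yes refl = x∈p∪q⁺ (inj₁ (x∈⁅x⁆ x))
    ... | no  y≢x  = x∈p∪q⁺ (inj₂ (x∈p∧x≢y⇒x∈p-y y∈p y≢x))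

  neighbours : (Fin k → Subset n) → Subset k → Subset n
  neighbours R []            = ∅
  neighbours R (outside ∷ S) = neighbours (R ∘ suc) S
  neighbours R (inside  ∷ S) = R zero ∪ neighbours (R ∘ suc) S

  ∈-neighbours⁺ : ∀ (R : Fin k → Subset n) {S x y} → x ∈ S → y ∈ R x → y ∈ neighbours R S
  ∈-neighbours⁺ R {inside  ∷ S} here        y∈Rx = x∈p∪q⁺ (inj₁ y∈Rx)
  ∈-neighbours⁺ R {inside  ∷ S} (there x∈S) y∈Rx = x∈p∪q⁺ (inj₂ (∈-neighbours⁺ (R ∘ suc) x∈S y∈Rx))
  ∈-neighbours⁺ R {outside ∷ S} (there x∈S) y∈Rx = ∈-neighbours⁺ (R ∘ suc) x∈S y∈Rx

  ∈-neighbours⁻ : ∀ (R : Fin k → Subset n) S {y} → y ∈ neighbours R S → ∃ λ x → x ∈ S × y ∈ R x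
  ∈-neighbours⁻ R []            y∈N = contradiction y∈N ∉⊥
  ∈-neighbours⁻ R (outside ∷ S) y∈N with ∈-neighbours⁻ (R ∘ suc) S y∈N
  ... | x , x∈S , y∈Rx = suc x , there x∈S , y∈Rx
  ∈-neighbours⁻ R (inside  ∷ S) y∈N with x∈p∪q⁻ (R zero) _ y∈N
  ... | inj₁ y∈R0 = zero , here , y∈R0
  ... | inj₂ y∈N′ with ∈-neighbours⁻ (R ∘ suc) S y∈N′
  ...   | x , x∈S , y∈Rx = suc x , there x∈S , y∈Rx

  HallCondition : (Fin k → Subset n) → Set
  HallCondition R = ∀ S → ∣ S ∣ ≤ ∣ neighbours R S ∣

  Deficient : (Fin k → Subset n) → Subset k → Set
  Deficient R S = ∣ neighbours R S ∣ < ∣ S ∣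

  hallCondition? : (R : Fin k → Subset n) → HallCondition R ⊎ ∃ (Deficient R)
  hallCondition? R with anySubset? (λ S → suc ∣ neighbours R S ∣ ≤? ∣ S ∣)
  ... | yes deficient  = inj₂ deficient
  ... | no  ¬deficient = inj₁ λ S → ≮⇒≥ (¬deficient ∘ (S ,_))

  hall-⊆ : ∀ {R : Fin k → Subset n} {q} → HallCondition R → ∀ S → neighbours R S ⊆ q → ∣ S ∣ ≤ ∣ q ∣
  hall-⊆ hallR S N⊆q = ≤-trans (hallR S) (p⊆q⇒∣p∣≤∣q∣ N⊆q)

  Transversal : (Fin k → Subset n) → Set
  Transversal {k} {n} R = Σ (Fin k → Fin n) λ σ → (∀ x → σ x ∈ R x) × Injective _≡_ _≡_ σ

  transversal-⊆ : ∀ {R R′ : Fin k → Subset n} → (∀ x → R′ x ⊆ R x) → Transversal R′ → Transversal R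
  transversal-⊆ R′⊆R (σ , σ∈R′ , σ-injective) = σ , (λ x → R′⊆R x (σ∈R′ x)) , σ-injective

  Branching : (Fin k → Subset n) → Set
  Branching R = ∃ λ x → ∃₂ λ y₁ y₂ → y₁ ∈ R x × y₂ ∈ R x × y₁ ≢ y₂

  branching? : (R : Fin k → Subset n) → Dec (Branching R)
  branching? R = any? λ x → any? λ y₁ → any? λ y₂ → (y₁ ∈? R x) ×-dec (y₂ ∈? R x) ×-dec ¬? (y₁ ≟ y₂)

  unbranched-transversal : ∀ {k n} {R : Fin k → Subset n} → HallCondition R → ¬ Branching R → Transversal R
  unbranched-transversal {k} {n} {R} hallR unbranched = σ , σ∈R , σ-injective
    where
    unique : ∀ x {y y′} → y ∈ R x → y′ ∈ R x → y ≡ y′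
    unique x {y} {y′} y∈Rx y′∈Rx with y ≟ y′
    ... | yes y≡y′ = y≡y′
    ... | no  y≢y′ = contradiction (x , y , y′ , y∈Rx , y′∈Rx , y≢y′) unbranched
    representative : ∀ x → ∃ λ y → y ∈ R x
    representative x with 1≤∣p∣⇒Nonempty (subst (_≤ ∣ neighbours R ⁅ x ⁆ ∣) (∣⁅x⁆∣≡1 x) (hallR ⁅ x ⁆))
    ... | y , y∈N with ∈-neighbours⁻ R ⁅ x ⁆ y∈N
    ...   | z , z∈⁅x⁆ , y∈Rz = y , subst (λ w → y ∈ R w) (x∈⁅y⁆⇒x≡y x z∈⁅x⁆) y∈Rz
    σ : Fin k → Fin n
    σ x = proj₁ (representative x)
    σ∈R : ∀ x → σ x ∈ R x
    σ∈R x = proj₂ (representative x)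
    σ-injective : Injective _≡_ _≡_ σ
    σ-injective {x} {x′} σx≡σx′ with x ≟ x′
    ... | yes x≡x′ = x≡x′
    ... | no  x≢x′ = contradiction (hall-⊆ hallR S N⊆⁅σx⁆) (<⇒≱ (begin-strict
        ∣ ⁅ σ x ⁆ ∣ ≡⟨ ∣⁅x⁆∣≡1 (σ x) ⟩
        1           <⟨ x∈p∧y∈p∧x≢y⇒2≤∣p∣ (x∈p∪q⁺ (inj₁ (x∈⁅x⁆ x))) (x∈p∪q⁺ (inj₂ (x∈⁅x⁆ x′))) x≢x′ ⟩
        ∣ S ∣       ∎))
      where
      open ≤-Reasoning
      S = ⁅ x ⁆ ∪ ⁅ x′ ⁆
      N⊆⁅σx⁆ : neighbours R S ⊆ ⁅ σ x ⁆
      N⊆⁅σx⁆ {y} y∈N with ∈-neighbours⁻ R S y∈N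
      ... | z , z∈S , y∈Rz with x∈p∪q⁻ ⁅ x ⁆ ⁅ x′ ⁆ z∈S
      ...   | inj₁ z∈⁅x⁆ rewrite x∈⁅y⁆⇒x≡y x z∈⁅x⁆ =
        subst (_∈ ⁅ σ x ⁆) (unique x (σ∈R x) y∈Rz) (x∈⁅x⁆ (σ x))
      ...   | inj₂ z∈⁅x′⁆ rewrite x∈⁅y⁆⇒x≡y x′ z∈⁅x′⁆ =
        subst (_∈ ⁅ σ x ⁆) (trans σx≡σx′ (unique x′ (σ∈R x′) y∈Rz)) (x∈⁅x⁆ (σ x))

  deleteEdge : (Fin k → Subset n) → Fin k → Fin n → Fin k → Subset n
  deleteEdge R x y z with z ≟ x
  ... | yes _ = R z - y
  ... | no  _ = R z

  deleteEdge-⊆ : ∀ (R : Fin k → Subset n) {x y} z → deleteEdge R x y z ⊆ R z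
  deleteEdge-⊆ R {x} {y} z with z ≟ x
  ... | yes _ = p─q⊆p (R z) ⁅ y ⁆
  ... | no  _ = λ w∈Rz → w∈Rz

  ∈-deleteEdge⁺ : ∀ (R : Fin k → Subset n) {x y z w} → w ∈ R z → z ≢ x ⊎ w ≢ y → w ∈ deleteEdge R x y z
  ∈-deleteEdge⁺ R {x} {z = z} w∈Rz z≢x⊎w≢y with z ≟ x | z≢x⊎w≢y
  ... | no  _   | _        = w∈Rz
  ... | yes z≡x | inj₁ z≢x = contradiction z≡x z≢x
  ... | yes _   | inj₂ w≢y = x∈p∧x≢y⇒x∈p-y w∈Rz w≢y

  ∣deleteEdge∣<∣R∣ : ∀ (R : Fin k → Subset n) {x y} → y ∈ R x → ∣ deleteEdge R x y x ∣ < ∣ R x ∣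
  ∣deleteEdge∣<∣R∣ R {x} y∈Rx with x ≟ x
  ... | yes _   = x∈p⇒∣p-x∣<∣p∣ y∈Rx
  ... | no  x≢x = contradiction refl x≢x

  edgeCount : (Fin k → Subset n) → ℕ
  edgeCount {zero}  R = 0
  edgeCount {suc k} R = ∣ R zero ∣ + edgeCount (R ∘ suc)

  edgeCount-mono-≤ : ∀ {R R′ : Fin k → Subset n} → (∀ z → R′ z ⊆ R z) → edgeCount R′ ≤ edgeCount R
  edgeCount-mono-≤ {zero}  R′⊆R = z≤n
  edgeCount-mono-≤ {suc k} R′⊆R = +-mono-≤ (p⊆q⇒∣p∣≤∣q∣ (R′⊆R zero)) (edgeCount-mono-≤ (R′⊆R ∘ suc))

  edgeCount-mono-< : ∀ {R R′ : Fin k → Subset n} → (∀ z → R′ z ⊆ R z) →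
    ∀ x → ∣ R′ x ∣ < ∣ R x ∣ → edgeCount R′ < edgeCount R
  edgeCount-mono-< R′⊆R zero    <x = +-mono-<-≤ <x (edgeCount-mono-≤ (R′⊆R ∘ suc))
  edgeCount-mono-< R′⊆R (suc x) <x =
    +-mono-≤-< (p⊆q⇒∣p∣≤∣q∣ (R′⊆R zero)) (edgeCount-mono-< (R′⊆R ∘ suc) x <x)

  edgeCount-deleteEdge : ∀ (R : Fin k → Subset n) {x y} → y ∈ R x →
    edgeCount (deleteEdge R x y) < edgeCount R
  edgeCount-deleteEdge R {x} y∈Rx = edgeCount-mono-< (deleteEdge-⊆ R) x (∣deleteEdge∣<∣R∣ R y∈Rx)

  deficient-deleteEdge⇒∈ : ∀ {R : Fin k → Subset n} {x y} S → HallCondition R →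
    Deficient (deleteEdge R x y) S → x ∈ S
  deficient-deleteEdge⇒∈ {R = R} {x} {y} S hallR deficient with x ∈? S
  ... | yes x∈S = x∈S
  ... | no  x∉S = contradiction (hall-⊆ hallR S N⊆N′) (<⇒≱ deficient)
    where
    N⊆N′ : neighbours R S ⊆ neighbours (deleteEdge R x y) S
    N⊆N′ w∈N with ∈-neighbours⁻ R S w∈N
    ... | z , z∈S , w∈Rz =
      ∈-neighbours⁺ _ z∈S (∈-deleteEdge⁺ R w∈Rz (inj₁ λ z≡x → x∉S (subst (_∈ S) z≡x z∈S)))

  neighbours-∪-deleteEdge : ∀ (R : Fin k → Subset n) {x y₁ y₂ S₁ S₂} → x ∈ S₁ → x ∈ S₂ → y₁ ≢ y₂ →
    neighbours R (S₁ ∪ S₂) ⊆ neighbours (deleteEdge R x y₁) S₁ ∪ neighbours (deleteEdge R x y₂) S₂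
  neighbours-∪-deleteEdge R {x} {y₁} {y₂} {S₁} {S₂} x∈S₁ x∈S₂ y₁≢y₂ {w} w∈N
    with ∈-neighbours⁻ R (S₁ ∪ S₂) w∈N
  ... | z , z∈S , w∈Rz with z ≟ x | w ≟ y₁ | x∈p∪q⁻ S₁ S₂ z∈S
  ...   | no z≢x   | _        | inj₁ z∈S₁ = x∈p∪q⁺ (inj₁ (∈-neighbours⁺ _ z∈S₁ (∈-deleteEdge⁺ R w∈Rz (inj₁ z≢x))))
  ...   | no z≢x   | _        | inj₂ z∈S₂ = x∈p∪q⁺ (inj₂ (∈-neighbours⁺ _ z∈S₂ (∈-deleteEdge⁺ R w∈Rz (inj₁ z≢x))))
  ...   | yes refl | no w≢y₁  | _ = x∈p∪q⁺ (inj₁ (∈-neighbours⁺ _ x∈S₁ (∈-deleteEdge⁺ R w∈Rz (inj₂ w≢y₁))))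
  ...   | yes refl | yes refl | _ = x∈p∪q⁺ (inj₂ (∈-neighbours⁺ _ x∈S₂ (∈-deleteEdge⁺ R w∈Rz (inj₂ y₁≢y₂))))

  neighbours-∩-deleteEdge : ∀ (R : Fin k → Subset n) {x y₁ y₂} S₁ S₂ →
    neighbours R (S₁ ∩ S₂ - x) ⊆ neighbours (deleteEdge R x y₁) S₁ ∩ neighbours (deleteEdge R x y₂) S₂
  neighbours-∩-deleteEdge R {x} S₁ S₂ w∈N with ∈-neighbours⁻ R (S₁ ∩ S₂ - x) w∈N
  ... | z , z∈S , w∈Rz with x∈p∩q⁻ S₁ S₂ (p─q⊆p (S₁ ∩ S₂) ⁅ x ⁆ z∈S)
  ...   | z∈S₁ , z∈S₂ = x∈p∩q⁺ (∈-neighbours⁺ _ z∈S₁ (∈-deleteEdge⁺ R w∈Rz (inj₁ z≢x)) ,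
                                ∈-neighbours⁺ _ z∈S₂ (∈-deleteEdge⁺ R w∈Rz (inj₁ z≢x)))
    where z≢x = x∈p-y⇒x≢y {p = S₁ ∩ S₂} z∈S

  -- Both sets contain x, and in R the neighbours of S₁ ∪ S₂ and of S₁ ∩ S₂ − x lie in N₁ ∪ N₂ and
  -- N₁ ∩ N₂; so Hall's condition for R gives |S₁| + |S₂| − 1 ≤ |N₁| + |N₂|, against |Nᵢ| < |Sᵢ|.
  not-both-deficient : ∀ {R : Fin k → Subset n} {x y₁ y₂} S₁ S₂ → HallCondition R → y₁ ≢ y₂ →
    Deficient (deleteEdge R x y₁) S₁ → Deficient (deleteEdge R x y₂) S₂ → ⊥
  not-both-deficient {R = R} {x} {y₁} {y₂} S₁ S₂ hallR y₁≢y₂ deficient₁ deficient₂ = 1+n≰n (begin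
    suc (suc (∣ N₁ ∣ + ∣ N₂ ∣))            ≡⟨ cong suc (+-suc ∣ N₁ ∣ ∣ N₂ ∣) ⟨
    suc ∣ N₁ ∣ + suc ∣ N₂ ∣                ≤⟨ +-mono-≤ deficient₁ deficient₂ ⟩
    ∣ S₁ ∣ + ∣ S₂ ∣                        ≡⟨ ∣p∪q∣+∣p∩q∣≡∣p∣+∣q∣ S₁ S₂ ⟨
    ∣ S₁ ∪ S₂ ∣ + ∣ S₁ ∩ S₂ ∣              ≤⟨ +-monoʳ-≤ ∣ S₁ ∪ S₂ ∣ (∣p∣≤1+∣p-x∣ (S₁ ∩ S₂) x) ⟩
    ∣ S₁ ∪ S₂ ∣ + suc ∣ S₁ ∩ S₂ - x ∣      ≡⟨ +-suc _ _ ⟩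
    suc (∣ S₁ ∪ S₂ ∣ + ∣ S₁ ∩ S₂ - x ∣)    ≤⟨ s≤s (+-mono-≤ (hall-⊆ hallR (S₁ ∪ S₂) ∪-covered)
                                                            (hall-⊆ hallR (S₁ ∩ S₂ - x) ∩-covered)) ⟩
    suc (∣ N₁ ∪ N₂ ∣ + ∣ N₁ ∩ N₂ ∣)        ≡⟨ cong suc (∣p∪q∣+∣p∩q∣≡∣p∣+∣q∣ N₁ N₂) ⟩
    suc (∣ N₁ ∣ + ∣ N₂ ∣)                  ∎)
    where
    open ≤-Reasoning
    N₁ = neighbours (deleteEdge R x y₁) S₁
    N₂ = neighbours (deleteEdge R x y₂) S₂
    ∪-covered = neighbours-∪-deleteEdge R (deficient-deleteEdge⇒∈ S₁ hallR deficient₁)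
                                          (deficient-deleteEdge⇒∈ S₂ hallR deficient₂) y₁≢y₂
    ∩-covered = neighbours-∩-deleteEdge R S₁ S₂

  deleteEdge-hall : ∀ {R : Fin k → Subset n} {x y₁ y₂} → HallCondition R → y₁ ≢ y₂ →
    HallCondition (deleteEdge R x y₁) ⊎ HallCondition (deleteEdge R x y₂)
  deleteEdge-hall {R = R} {x} {y₁} {y₂} hallR y₁≢y₂
    with hallCondition? (deleteEdge R x y₁) | hallCondition? (deleteEdge R x y₂)
  ... | inj₁ hall₁             | _                     = inj₁ hall₁
  ... | inj₂ _                 | inj₁ hall₂            = inj₂ hall₂
  ... | inj₂ (S₁ , deficient₁) | inj₂ (S₂ , deficient₂) =
    ⊥-elim (not-both-deficient S₁ S₂ hallR y₁≢y₂ deficient₁ deficient₂)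

  -- Induction on the number of edges: as long as some vertex has two neighbours, one of the two
  -- edges can be deleted without violating Hall's condition.
  hall : ∀ {R : Fin k → Subset n} → HallCondition R → Transversal R
  hall {R = R} = All.wfRec (On.wellFounded edgeCount <-wellFounded) _
    (λ R → HallCondition R → Transversal R) step R
    where
    step : ∀ R → (∀ {R′} → edgeCount R′ < edgeCount R → HallCondition R′ → Transversal R′) →
      HallCondition R → Transversal R
    step R rec hallR with branching? R
    ... | no  unbranched = unbranched-transversal hallR unbranched
    ... | yes (x , y₁ , y₂ , y₁∈Rx , y₂∈Rx , y₁≢y₂) with deleteEdge-hall hallR y₁≢y₂
    ...   | inj₁ hall₁ = transversal-⊆ (deleteEdge-⊆ R) (rec (edgeCount-deleteEdge R y₁∈Rx) hall₁)
    ...   | inj₂ hall₂ = transversal-⊆ (deleteEdge-⊆ R) (rec (edgeCount-deleteEdge R y₂∈Rx) hall₂)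

module ExtremePoints where

  open Hall using (HallCondition; neighbours; ∈-neighbours⁺; hall)
  open import Algebra.Bundles using (CommutativeRing)
  open import Data.Bool using (if_then_else_; true; false)
  open import Data.Bool.Properties using (T-≡)
  open import Data.Fin using (Fin; zero; suc; _≟_; opposite; toℕ; punchOut)
  import Data.Fin.Properties as Fin
  open import Data.Fin.Permutation using (Permutation′; permutation; _⟨$⟩ʳ_; _⟨$⟩ˡ_; inverseˡ; inverseʳ; reverse)
  open import Data.Fin.Subset using (Subset; _∈_; _∉_; ∣_∣; inside; outside)
  open import Data.Fin.Subset.Properties using (_∈?_)
  open import Data.Nat as ℕ using (ℕ; zero; suc; _∸_)
  import Data.Nat.Properties as ℕ
  open import Data.Product using (Σ; ∃; _×_; _,_; proj₁; proj₂)
  open import Data.Rational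
    using (ℚ; 0ℚ; 1ℚ; ½; _+_; _*_; _-_; -_; _≤_; _<_; _⊓_; _<?_; positive; nonNegative)
  open import Data.Rational.Properties
    using (≤-refl; ≤-reflexive; ≤-trans; ≤-antisym; <-trans; <-≤-trans; <-irrefl; <⇒≤; ≮⇒≥; <-respˡ-≡;
           +-comm; +-identityˡ; +-identityʳ; +-inverseʳ; +-mono-≤; +-monoˡ-≤; +-mono-<; +-monoˡ-<;
           *-identityʳ; *-zeroʳ; *-monoˡ-≤-nonNeg; *-monoʳ-≤-nonNeg; *-cancelˡ-≤-pos;
           nonNeg*nonNeg⇒nonNeg; positive⁻¹; nonNegative⁻¹; ⊓-sel; p⊓q≤p; p⊓q≤q;
           +-*-commutativeRing; module ≤-Reasoning)
  open import Data.Rational.Solver using (module +-*-Solver)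
  open import Data.Sum using (_⊎_; inj₁; inj₂)
  open import Data.Vec using ([]; _∷_; lookup; tabulate)
  open import Data.Vec.Properties using (lookup∘tabulate; []=⇒lookup; lookup⇒[]=)
  open import Function using (_∘_)
  open import Function.Bundles using (Equivalence)
  open import Function.Definitions using (Injective)
  open import Relation.Binary.Definitions using (tri<; tri≈; tri>)
  open import Relation.Binary.PropositionalEquality
    using (_≡_; _≢_; refl; sym; trans; cong; cong₂; subst; module ≡-Reasoning)
  open import Relation.Nullary using (yes; no; contradiction)
  open import Relation.Nullary.Decidable using (isYes; toWitness; fromWitness)

  open import Algebra.Properties.Semiring.Sum (CommutativeRing.semiring +-*-commutativeRing)
    using (sum; sum-replicate-zero; ∑-distrib-+; ∑-comm; *-distribˡ-sum; sum-cong-≗; ∑-permute)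
  open +-*-Solver using (solve; _:+_; _:*_; _:-_; :-_; _:=_; con)

  private
    variable
      n : ℕ
      ε a b : ℚ
      A B P : Matrix n

  sumFin≡sum : ∀ n (f : Fin n → ℚ) → sumFin n f ≡ sum f
  sumFin≡sum zero    f = refl
  sumFin≡sum (suc n) f = cong (f zero +_) (sumFin≡sum n (f ∘ suc))

  sumFin-cong : ∀ n {f g : Fin n → ℚ} → (∀ i → f i ≡ g i) → sumFin n f ≡ sumFin n g
  sumFin-cong n {f} {g} f≗g = trans (sumFin≡sum n f) (trans (sum-cong-≗ f≗g) (sym (sumFin≡sum n g)))

  sum-mono-≤ : ∀ {n} {f g : Fin n → ℚ} → (∀ i → f i ≤ g i) → sum f ≤ sum g
  sum-mono-≤ {zero}  f≤g = ≤-refl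
  sum-mono-≤ {suc n} f≤g = +-mono-≤ (f≤g zero) (sum-mono-≤ (f≤g ∘ suc))

  sum-single : ∀ {n} {f : Fin n → ℚ} i₀ → (∀ i → i ≢ i₀ → f i ≡ 0ℚ) → sum f ≡ f i₀
  sum-single {suc n} {f} zero     f≡0 =
    trans (cong (f zero +_) (trans (sum-cong-≗ (λ i → f≡0 (suc i) λ ())) (sum-replicate-zero n)))
          (+-identityʳ (f zero))
  sum-single {suc n} {f} (suc i₀) f≡0 =
    trans (cong (_+ sum (f ∘ suc)) (f≡0 zero λ ()))
          (trans (+-identityˡ _) (sum-single i₀ (λ i i≢i₀ → f≡0 (suc i) (i≢i₀ ∘ Fin.suc-injective))))

  doublyStochastic-rowSum : DoublyStochastic A → ∀ i → sum (A i) ≡ 1ℚ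
  doublyStochastic-rowSum {n} {A} (_ , rows , _) i = trans (sym (sumFin≡sum n (A i))) (rows i)

  doublyStochastic-colSum : DoublyStochastic A → ∀ j → sum (λ i → A i j) ≡ 1ℚ
  doublyStochastic-colSum {n} {A} (_ , _ , cols) j = trans (sym (sumFin≡sum n (λ i → A i j))) (cols j)

  mkInΩth : (∀ i j → 0ℚ ≤ A i j) → (∀ i → sumFin n (A i) ≡ 1ℚ) →
    transpose A ≋ A → hankelTranspose A ≋ A → InΩth A
  mkInΩth {n} {A} nonNeg rows symmetric hankel =
    (nonNeg , rows , λ j → trans (sumFin-cong n (symmetric j)) (rows j)) , symmetric , hankel

  0≤p*q : 0ℚ ≤ a → 0ℚ ≤ b → 0ℚ ≤ a * b
  0≤p*q {a} {b} 0≤a 0≤b = nonNegative⁻¹ _ {{nonNeg*nonNeg⇒nonNeg a {{nonNegative 0≤a}} b {{nonNegative 0≤b}}}}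

  p≤q⇒0≤q-p : a ≤ b → 0ℚ ≤ b - a
  p≤q⇒0≤q-p {a} {b} a≤b = subst (_≤ b - a) (+-inverseʳ a) (+-monoˡ-≤ (- a) a≤b)

  0<p⊓q : 0ℚ < a → 0ℚ < b → 0ℚ < a ⊓ b
  0<p⊓q {a} {b} 0<a 0<b with ⊓-sel a b
  ... | inj₁ a⊓b≡a = subst (0ℚ <_) (sym a⊓b≡a) 0<a
  ... | inj₂ a⊓b≡b = subst (0ℚ <_) (sym a⊓b≡b) 0<b

  *-cancelˡ-≡-pos : 0ℚ < ε → ε * a ≡ ε * b → a ≡ b
  *-cancelˡ-≡-pos {ε} 0<ε εa≡εb =
    ≤-antisym (*-cancelˡ-≤-pos ε (≤-reflexive εa≡εb)) (*-cancelˡ-≤-pos ε (≤-reflexive (sym εa≡εb)))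
    where instance _ = positive 0<ε

  δ : Fin n → Fin n → ℚ
  δ i j with i ≟ j
  ... | yes _ = 1ℚ
  ... | no  _ = 0ℚ

  δ-≡ : ∀ {i j : Fin n} → i ≡ j → δ i j ≡ 1ℚ
  δ-≡ {i = i} {j} i≡j with i ≟ j
  ... | yes _   = refl
  ... | no  i≢j = contradiction i≡j i≢j

  δ-≢ : ∀ {i j : Fin n} → i ≢ j → δ i j ≡ 0ℚ
  δ-≢ {i = i} {j} i≢j with i ≟ j
  ... | yes i≡j = contradiction i≡j i≢j
  ... | no  _   = refl

  δ-nonNeg : ∀ (i j : Fin n) → 0ℚ ≤ δ i j
  δ-nonNeg i j with i ≟ j
  ... | yes _ = <⇒≤ (positive⁻¹ 1ℚ)
  ... | no  _ = ≤-refl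

  δ-cong : ∀ {i j k l : Fin n} → (i ≡ j → k ≡ l) → (k ≡ l → i ≡ j) → δ i j ≡ δ k l
  δ-cong {i = i} {j} to from with i ≟ j
  ... | yes i≡j = sym (δ-≡ (to i≡j))
  ... | no  i≢j = sym (δ-≢ (i≢j ∘ from))

  sum-δ : ∀ (f g : Fin n → Fin n) i₀ → f i₀ ≡ g i₀ → (∀ i → f i ≡ g i → i ≡ i₀) →
    sumFin n (λ i → δ (f i) (g i)) ≡ 1ℚ
  sum-δ {n} f g i₀ fi₀≡gi₀ unique = begin
    sumFin n (λ i → δ (f i) (g i)) ≡⟨ sumFin≡sum n _ ⟩
    sum (λ i → δ (f i) (g i))      ≡⟨ sum-single i₀ (λ i i≢i₀ → δ-≢ (i≢i₀ ∘ unique i)) ⟩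
    δ (f i₀) (g i₀)                ≡⟨ δ-≡ fi₀≡gi₀ ⟩
    1ℚ                             ∎
    where open ≡-Reasoning

  injective⇒surjective : ∀ {σ : Fin n → Fin n} → Injective _≡_ _≡_ σ → ∀ j → ∃ λ i → σ i ≡ j
  injective⇒surjective {suc n} {σ} σ-injective j with Fin.any? (λ i → σ i ≟ j)
  ... | yes hit = hit
  ... | no  miss with Fin.pigeonhole (ℕ.n<1+n n) (λ i → punchOut {i = j} (miss ∘ (i ,_) ∘ sym))
  ...   | i , i′ , i<i′ , same = contradiction
    (σ-injective (Fin.punchOut-injective (miss ∘ (i ,_) ∘ sym) (miss ∘ (i′ ,_) ∘ sym) same)) (Fin.<⇒≢ i<i′)

  injective⇒permutation : ∀ {σ : Fin n → Fin n} → Injective _≡_ _≡_ σ → Permutation′ n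
  injective⇒permutation {σ = σ} σ-injective = permutation σ σ⁻¹ σ∘σ⁻¹ (λ i → σ-injective (σ∘σ⁻¹ (σ i)))
    where
    σ⁻¹ = λ j → proj₁ (injective⇒surjective σ-injective j)
    σ∘σ⁻¹ = λ j → proj₂ (injective⇒surjective σ-injective j)

  permutationMatrix : Permutation′ n → Matrix n
  permutationMatrix π i j = δ (π ⟨$⟩ʳ i) j

  permutationMatrix-doublyStochastic : ∀ (π : Permutation′ n) → DoublyStochastic (permutationMatrix π)
  permutationMatrix-doublyStochastic π =
    (λ i j → δ-nonNeg (π ⟨$⟩ʳ i) j) ,
    (λ i → sum-δ _ (λ j → j) (π ⟨$⟩ʳ i) refl (λ j πi≡j → sym πi≡j)) ,
    (λ j → sum-δ (π ⟨$⟩ʳ_) _ (π ⟨$⟩ˡ j) (inverseʳ π)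
                 (λ i πi≡j → trans (sym (inverseˡ π)) (cong (π ⟨$⟩ˡ_) πi≡j)))

  δ-permute : ∀ (π : Permutation′ n) i j → δ (π ⟨$⟩ʳ i) j ≡ δ (π ⟨$⟩ˡ j) i
  δ-permute π i j = δ-cong (λ πi≡j → trans (cong (π ⟨$⟩ˡ_) (sym πi≡j)) (inverseˡ π))
                           (λ π⁻¹j≡i → trans (cong (π ⟨$⟩ʳ_) (sym π⁻¹j≡i)) (inverseʳ π))

  ℕ→ℚ : ℕ → ℚ
  ℕ→ℚ zero    = 0ℚ
  ℕ→ℚ (suc k) = 1ℚ + ℕ→ℚ k

  ℕ→ℚ-<-suc : ∀ k → ℕ→ℚ k < ℕ→ℚ (suc k)
  ℕ→ℚ-<-suc k = <-respˡ-≡ (+-identityˡ (ℕ→ℚ k)) (+-monoˡ-< (ℕ→ℚ k) (positive⁻¹ 1ℚ))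

  ℕ→ℚ-mono-< : ∀ {k l} → k ℕ.< l → ℕ→ℚ k < ℕ→ℚ l
  ℕ→ℚ-mono-< {k} {suc l} (ℕ.s≤s k≤l) with ℕ.m≤n⇒m<n∨m≡n k≤l
  ... | inj₁ k<l  = <-trans (ℕ→ℚ-mono-< k<l) (ℕ→ℚ-<-suc l)
  ... | inj₂ refl = ℕ→ℚ-<-suc k

  ℕ→ℚ-cancel-≤ : ∀ {k l} → ℕ→ℚ k ≤ ℕ→ℚ l → k ℕ.≤ l
  ℕ→ℚ-cancel-≤ k≤l = ℕ.≮⇒≥ λ l<k → <-irrefl refl (<-≤-trans (ℕ→ℚ-mono-< l<k) k≤l)

  𝟙 : Subset n → Fin n → ℚ
  𝟙 S i = if lookup S i then 1ℚ else 0ℚ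

  𝟙-∈ : ∀ {S : Subset n} {i} → i ∈ S → 𝟙 S i ≡ 1ℚ
  𝟙-∈ i∈S = cong (λ b → if b then 1ℚ else 0ℚ) ([]=⇒lookup i∈S)

  𝟙-∉ : ∀ {S : Subset n} {i} → i ∉ S → 𝟙 S i ≡ 0ℚ
  𝟙-∉ {S = S} {i} i∉S with lookup S i in S[i]
  ... | true  = contradiction (lookup⇒[]= i S S[i]) i∉S
  ... | false = refl

  𝟙-nonNeg : ∀ (S : Subset n) i → 0ℚ ≤ 𝟙 S i
  𝟙-nonNeg S i with lookup S i
  ... | true  = <⇒≤ (positive⁻¹ 1ℚ)
  ... | false = ≤-refl

  sum-𝟙 : ∀ (S : Subset n) → sum (𝟙 S) ≡ ℕ→ℚ ∣ S ∣
  sum-𝟙 []            = refl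
  sum-𝟙 (inside  ∷ S) = cong (1ℚ +_) (sum-𝟙 S)
  sum-𝟙 (outside ∷ S) = trans (+-identityˡ _) (sum-𝟙 S)

  support : Matrix n → Fin n → Subset n
  support A i = tabulate λ j → isYes (0ℚ <? A i j)

  ∈-support⁺ : ∀ {A : Matrix n} {i j} → 0ℚ < A i j → j ∈ support A i
  ∈-support⁺ {A = A} {i} {j} 0<Aij = lookup⇒[]= j _
    (trans (lookup∘tabulate _ j) (Equivalence.to T-≡ (fromWitness {a? = 0ℚ <? A i j} 0<Aij)))

  ∈-support⁻ : ∀ {A : Matrix n} {i j} → j ∈ support A i → 0ℚ < A i j
  ∈-support⁻ {A = A} {i} {j} j∈support = toWitness {a? = 0ℚ <? A i j}
    (Equivalence.from T-≡ (trans (sym (lookup∘tabulate _ j)) ([]=⇒lookup j∈support)))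

  doublyStochastic-hall : DoublyStochastic A → HallCondition (support A)
  doublyStochastic-hall {n} {A} ds@(nonNeg , _ , _) S = ℕ→ℚ-cancel-≤ (begin
    ℕ→ℚ ∣ S ∣                              ≡⟨ sum-𝟙 S ⟨
    sum (𝟙 S)                               ≡⟨ sum-cong-≗ (λ i → weighted-rowSum (𝟙 S i) i) ⟨
    sum (λ i → 𝟙 S i * sum (A i))            ≡⟨ sum-cong-≗ (λ i → *-distribˡ-sum (𝟙 S i) (A i)) ⟩
    sum (λ i → sum (λ j → 𝟙 S i * A i j))     ≤⟨ sum-mono-≤ (λ i → sum-mono-≤ (𝟙-weighted i)) ⟩
    sum (λ i → sum (λ j → 𝟙 N j * A i j))     ≡⟨ ∑-comm (λ i j → 𝟙 N j * A i j) ⟩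
    sum (λ j → sum (λ i → 𝟙 N j * A i j))     ≡⟨ sum-cong-≗ (λ j → *-distribˡ-sum (𝟙 N j) (λ i → A i j)) ⟨
    sum (λ j → 𝟙 N j * sum (λ i → A i j))     ≡⟨ sum-cong-≗ (λ j → weighted-colSum (𝟙 N j) j) ⟩
    sum (𝟙 N)                               ≡⟨ sum-𝟙 N ⟩
    ℕ→ℚ ∣ N ∣                              ∎)
    where
    open ≤-Reasoning
    N = neighbours (support A) S
    weighted-rowSum : ∀ c i → c * sum (A i) ≡ c
    weighted-rowSum c i = trans (cong (c *_) (doublyStochastic-rowSum {A = A} ds i)) (*-identityʳ c)
    weighted-colSum : ∀ c j → c * sum (λ i → A i j) ≡ c
    weighted-colSum c j = trans (cong (c *_) (doublyStochastic-colSum {A = A} ds j)) (*-identityʳ c)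
    𝟙-≤ : ∀ i j → 0ℚ < A i j → 𝟙 S i ≤ 𝟙 N j
    𝟙-≤ i j 0<Aij with i ∈? S
    ... | yes i∈S = ≤-reflexive (trans (𝟙-∈ i∈S)
                      (sym (𝟙-∈ (∈-neighbours⁺ (support A) i∈S (∈-support⁺ {A = A} 0<Aij)))))
    ... | no  i∉S = ≤-trans (≤-reflexive (𝟙-∉ i∉S)) (𝟙-nonNeg N j)
    𝟙-weighted : ∀ i j → 𝟙 S i * A i j ≤ 𝟙 N j * A i j
    𝟙-weighted i j with 0ℚ <? A i j
    ... | yes 0<Aij = *-monoʳ-≤-nonNeg (A i j) {{nonNegative (nonNeg i j)}} (𝟙-≤ i j 0<Aij)
    ... | no  Aij≯0 rewrite ≤-antisym (≮⇒≥ Aij≯0) (nonNeg i j) =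
      ≤-reflexive (trans (*-zeroʳ (𝟙 S i)) (sym (*-zeroʳ (𝟙 N j))))

  doublyStochastic⇒permutation : DoublyStochastic A → Σ (Permutation′ n) λ π → ∀ i → 0ℚ < A i (π ⟨$⟩ʳ i)
  doublyStochastic⇒permutation {A = A} ds with hall (doublyStochastic-hall ds)
  ... | σ , σ∈support , σ-injective = injective⇒permutation σ-injective , λ i → ∈-support⁻ {A = A} (σ∈support i)

  combo-∈Ω : ∀ {t} → (∀ i j → 0ℚ ≤ combo t B A i j) → InΩth B → InΩth A → InΩth (combo t B A)
  combo-∈Ω {n} {B} {A} {t} nonNeg (dsB , symB , hankelB) (dsA , symA , hankelA) =
    mkInΩth nonNeg rows
      (λ i j → cong₂ (λ b a → t * b + (1ℚ - t) * a) (symB i j) (symA i j))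
      (λ i j → cong₂ (λ b a → t * b + (1ℚ - t) * a) (hankelB i j) (hankelA i j))
    where
    rows : ∀ i → sumFin n (combo t B A i) ≡ 1ℚ
    rows i = begin
      sumFin n (combo t B A i)
        ≡⟨ sumFin≡sum n _ ⟩
      sum (λ j → t * B i j + (1ℚ - t) * A i j)
        ≡⟨ ∑-distrib-+ (λ j → t * B i j) (λ j → (1ℚ - t) * A i j) ⟩
      sum (λ j → t * B i j) + sum (λ j → (1ℚ - t) * A i j)
        ≡⟨ cong₂ _+_ (*-distribˡ-sum t (B i)) (*-distribˡ-sum (1ℚ - t) (A i)) ⟨
      t * sum (B i) + (1ℚ - t) * sum (A i)
        ≡⟨ cong₂ (λ b a → t * b + (1ℚ - t) * a) (doublyStochastic-rowSum {A = B} dsB i)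
                                               (doublyStochastic-rowSum {A = A} dsA i) ⟩
      t * 1ℚ + (1ℚ - t) * 1ℚ
        ≡⟨ solve 1 (λ t → t :* con 1ℚ :+ (con 1ℚ :- t) :* con 1ℚ := con 1ℚ) refl t ⟩
      1ℚ ∎
      where open ≡-Reasoning

  symmetrize : Matrix n → Matrix n
  symmetrize P i j =
    ¼ * (((P i j + transpose P i j) + hankelTranspose P i j) + transpose (hankelTranspose P) i j)

  symmetrize-symmetric : ∀ (P : Matrix n) → transpose (symmetrize P) ≋ symmetrize P
  symmetrize-symmetric P i j =
    solve 4 (λ a b c d → con ¼ :* (((b :+ a) :+ d) :+ c) := con ¼ :* (((a :+ b) :+ c) :+ d)) refl
      (P i j) (P j i) (P (opposite j) (opposite i)) (P (opposite i) (opposite j))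

  symmetrize-hankelSymmetric : ∀ (P : Matrix n) → hankelTranspose (symmetrize P) ≋ symmetrize P
  symmetrize-hankelSymmetric P i j rewrite Fin.opposite-involutive i | Fin.opposite-involutive j =
    solve 4 (λ a b c d → con ¼ :* (((c :+ d) :+ a) :+ b) := con ¼ :* (((a :+ b) :+ c) :+ d)) refl
      (P i j) (P j i) (P (opposite j) (opposite i)) (P (opposite i) (opposite j))

  sum-opposite : ∀ (f : Fin n → ℚ) → sum (f ∘ opposite) ≡ sum f
  sum-opposite f = sym (∑-permute f reverse)

  symmetrize-rowSum : DoublyStochastic P → ∀ i → sumFin n (symmetrize P i) ≡ 1ℚ
  symmetrize-rowSum {n} {P} ds i = begin
    sumFin n (symmetrize P i)
      ≡⟨ sumFin≡sum n _ ⟩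
    sum (symmetrize P i)
      ≡⟨ *-distribˡ-sum ¼ (λ j → ((f₁ j + f₂ j) + f₃ j) + f₄ j) ⟨
    ¼ * sum (λ j → ((f₁ j + f₂ j) + f₃ j) + f₄ j)
      ≡⟨ cong (¼ *_) distrib ⟩
    ¼ * (((sum f₁ + sum f₂) + sum f₃) + sum f₄)
      ≡⟨ cong (¼ *_) (cong₂ _+_ (cong₂ _+_ (cong₂ _+_ (row i) (col i))
                                           (trans (sum-opposite (λ j → P j (opposite i))) (col (opposite i))))
                                (trans (sum-opposite (P (opposite i))) (row (opposite i)))) ⟩
    ¼ * (((1ℚ + 1ℚ) + 1ℚ) + 1ℚ)
      ≡⟨⟩
    1ℚ ∎
    where
    open ≡-Reasoning
    row = doublyStochastic-rowSum {A = P} ds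
    col = doublyStochastic-colSum {A = P} ds
    f₁ f₂ f₃ f₄ : Fin n → ℚ
    f₁ j = P i j
    f₂ j = P j i
    f₃ j = P (opposite j) (opposite i)
    f₄ j = P (opposite i) (opposite j)
    distrib : sum (λ j → ((f₁ j + f₂ j) + f₃ j) + f₄ j) ≡ ((sum f₁ + sum f₂) + sum f₃) + sum f₄
    distrib = trans (∑-distrib-+ (λ j → (f₁ j + f₂ j) + f₃ j) f₄) (cong (_+ sum f₄)
                (trans (∑-distrib-+ (λ j → f₁ j + f₂ j) f₃) (cong (_+ sum f₃) (∑-distrib-+ f₁ f₂))))

  symmetrize-∈Ω : ∀ (P : Matrix n) → DoublyStochastic P → InΩth (symmetrize P)
  symmetrize-∈Ω P ds@(nonNeg , _ , _) =
    mkInΩth (λ i j → 0≤p*q (<⇒≤ (positive⁻¹ ¼))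
              (+-mono-≤ (+-mono-≤ (+-mono-≤ (nonNeg i j) (nonNeg j i)) (nonNeg (opposite j) (opposite i)))
                        (nonNeg (opposite i) (opposite j))))
            (symmetrize-rowSum ds) (symmetrize-symmetric P) (symmetrize-hankelSymmetric P)

  symmetrize-dominated : (∀ i j → ε * P i j ≤ A i j) → transpose A ≋ A → hankelTranspose A ≋ A →
    ∀ i j → ε * symmetrize P i j ≤ A i j
  symmetrize-dominated {ε = ε} {P = P} {A = A} εP≤A symmetric hankel i j = begin
    ε * symmetrize P i j
      ≡⟨ solve 5 (λ ε a b c d → ε :* (con ¼ :* (((a :+ b) :+ c) :+ d)) :=
                   con ¼ :* ((((ε :* a) :+ (ε :* b)) :+ (ε :* c)) :+ (ε :* d))) refl
           ε (P i j) (P j i) (P (opposite j) (opposite i)) (P (opposite i) (opposite j)) ⟩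
    ¼ * (((ε * P i j + ε * P j i) + ε * P (opposite j) (opposite i)) + ε * P (opposite i) (opposite j))
      ≤⟨ *-monoˡ-≤-nonNeg ¼ {{nonNegative (<⇒≤ (positive⁻¹ ¼))}}
           (+-mono-≤ (+-mono-≤ (+-mono-≤ (εP≤A i j) (≤-trans (εP≤A j i) (≤-reflexive (symmetric i j))))
                               (≤-trans (εP≤A _ _) (≤-reflexive (hankel i j))))
                     (≤-trans (εP≤A _ _) (≤-reflexive (trans (hankel j i) (symmetric i j))))) ⟩
    ¼ * (((A i j + A i j) + A i j) + A i j)
      ≡⟨ solve 1 (λ a → con ¼ :* (((a :+ a) :+ a) :+ a) := a) refl (A i j) ⟩
    A i j ∎
    where open ≤-Reasoning

  permutationMatrix-dominated : ∀ (π : Permutation′ n) → (∀ i j → 0ℚ ≤ A i j) →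
    (∀ i → ε ≤ A i (π ⟨$⟩ʳ i)) → ∀ i j → ε * permutationMatrix π i j ≤ A i j
  permutationMatrix-dominated {A = A} {ε} π nonNeg ε≤A i j with π ⟨$⟩ʳ i ≟ j
  ... | yes refl = ≤-trans (≤-reflexive (*-identityʳ ε)) (ε≤A i)
  ... | no  _    = ≤-trans (≤-reflexive (*-zeroʳ ε)) (nonNeg i j)

  positive-lowerBound : ∀ n (f : Fin n → ℚ) → (∀ i → 0ℚ < f i) →
    Σ ℚ λ ε → 0ℚ < ε × ε ≤ 1ℚ × ∀ i → ε ≤ f i
  positive-lowerBound zero    f 0<f = 1ℚ , positive⁻¹ 1ℚ , ≤-refl , λ ()
  positive-lowerBound (suc n) f 0<f with positive-lowerBound n (f ∘ suc) (0<f ∘ suc)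
  ... | ε , 0<ε , ε≤1 , ε≤f = f zero ⊓ ε , 0<p⊓q (0<f zero) 0<ε , ≤-trans (p⊓q≤q (f zero) ε) ε≤1 , bound
    where
    bound : ∀ i → f zero ⊓ ε ≤ f i
    bound zero    = p⊓q≤p (f zero) ε
    bound (suc i) = ≤-trans (p⊓q≤q (f zero) ε) (ε≤f i)

  combo-injective : ∀ {ε a b} → 0ℚ < ε → ε * b + (1ℚ - ε) * a ≡ (- ε) * b + (1ℚ - - ε) * a → a ≡ b
  combo-injective {ε} {a} {b} 0<ε same = *-cancelˡ-≡-pos (+-mono-< 0<ε 0<ε) (begin
    (ε + ε) * a                       ≡⟨ shift ⟩
    (ε + ε) * b + (rhs - lhs)         ≡⟨ cong (λ t → (ε + ε) * b + (t - lhs)) same ⟨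
    (ε + ε) * b + (lhs - lhs)         ≡⟨ cong ((ε + ε) * b +_) (+-inverseʳ lhs) ⟩
    (ε + ε) * b + 0ℚ                  ≡⟨ +-identityʳ _ ⟩
    (ε + ε) * b                       ∎)
    where
    open ≡-Reasoning
    lhs = ε * b + (1ℚ - ε) * a
    rhs = (- ε) * b + (1ℚ - - ε) * a
    shift : (ε + ε) * a ≡ (ε + ε) * b + (rhs - lhs)
    shift = solve 3 (λ ε a b → (ε :+ ε) :* a :=
      (ε :+ ε) :* b :+ (((:- ε) :* b :+ (con 1ℚ :- (:- ε)) :* a) :- (ε :* b :+ (con 1ℚ :- ε) :* a))) refl ε a b

  -- combo t B A = A + t (B − A); A is the midpoint of t = ±ε, and both points lie in Ω because εB ≤ A.
  extreme-dominating⇒≋ : IsExtreme InΩth A → InΩth B → 0ℚ < ε → ε ≤ 1ℚ →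
    (∀ i j → ε * B i j ≤ A i j) → A ≋ B
  extreme-dominating⇒≋ {A = A} {B = B} {ε = ε} (A∈Ω@((nonNegA , _) , _) , extreme) B∈Ω@((nonNegB , _) , _)
                        0<ε ε≤1 εB≤A i j = combo-injective 0<ε (segment i j)
    where
    nonNeg₊ : ∀ i j → 0ℚ ≤ combo ε B A i j
    nonNeg₊ i j = +-mono-≤ (0≤p*q (<⇒≤ 0<ε) (nonNegB i j)) (0≤p*q (p≤q⇒0≤q-p ε≤1) (nonNegA i j))
    nonNeg₋ : ∀ i j → 0ℚ ≤ combo (- ε) B A i j
    nonNeg₋ i j = subst (0ℚ ≤_)
      (solve 3 (λ ε a b → (a :- ε :* b) :+ ε :* a := (:- ε) :* b :+ (con 1ℚ :- (:- ε)) :* a) refl ε (A i j) (B i j))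
      (+-mono-≤ (p≤q⇒0≤q-p (εB≤A i j)) (0≤p*q (<⇒≤ 0<ε) (nonNegA i j)))
    midpoint : A ≋ combo ½ (combo ε B A) (combo (- ε) B A)
    midpoint i j = solve 3 (λ ε a b → a :=
      con ½ :* (ε :* b :+ (con 1ℚ :- ε) :* a) :+ (con 1ℚ :- con ½) :* ((:- ε) :* b :+ (con 1ℚ :- (:- ε)) :* a))
      refl ε (A i j) (B i j)
    segment : combo ε B A ≋ combo (- ε) B A
    segment = extreme (combo ε B A) (combo (- ε) B A) ½
      (combo-∈Ω {t = ε} nonNeg₊ B∈Ω A∈Ω) (combo-∈Ω {t = - ε} nonNeg₋ B∈Ω A∈Ω)
      (positive⁻¹ ½) (toWitness {a? = ½ <? 1ℚ} _) midpoint

  extreme⇒symmetrizedPermutation : IsExtreme InΩth A →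
    Σ (Permutation′ n) λ π → A ≋ symmetrize (permutationMatrix π)
  extreme⇒symmetrizedPermutation {n} {A} extreme@((ds@(nonNeg , _) , symmetric , hankel) , _) =
    let π , 0<A             = doublyStochastic⇒permutation {A = A} ds
        ε , 0<ε , ε≤1 , ε≤A = positive-lowerBound n (λ i → A i (π ⟨$⟩ʳ i)) 0<A
        P                   = permutationMatrix π
    in π , extreme-dominating⇒≋ {A = A} {B = symmetrize P} {ε = ε} extreme
             (symmetrize-∈Ω P (permutationMatrix-doublyStochastic π)) 0<ε ε≤1
             (symmetrize-dominated {ε = ε} {P = P} {A = A} (permutationMatrix-dominated {A = A} π nonNeg ε≤A)
                symmetric hankel)

  opposite-injective : ∀ {i j : Fin n} → opposite i ≡ opposite j → i ≡ j
  opposite-injective {i = i} {j} i′≡j′ =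
    trans (sym (Fin.opposite-involutive i)) (trans (cong opposite i′≡j′) (Fin.opposite-involutive j))

  δ-pair : Fin n → Fin n → ℚ
  δ-pair x j = δ x j + δ x (opposite j)

  δ-pair-opposite : ∀ (x j : Fin n) → δ-pair (opposite x) j ≡ δ-pair x j
  δ-pair-opposite x j = begin
    δ (opposite x) j + δ (opposite x) (opposite j)
      ≡⟨ cong₂ _+_ (δ-cong (λ x′≡j → trans (sym (Fin.opposite-involutive x)) (cong opposite x′≡j))
                           (λ x≡j′ → trans (cong opposite x≡j′) (Fin.opposite-involutive j)))
                   (δ-cong {k = x} {j} opposite-injective (cong opposite)) ⟩
    δ x (opposite j) + δ x j ≡⟨ +-comm (δ x (opposite j)) (δ x j) ⟩
    δ x j + δ x (opposite j) ∎
    where open ≡-Reasoning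

  δ-pair-self : ∀ {x : Fin n} → x ≢ opposite x → δ-pair x x ≡ 1ℚ
  δ-pair-self {x = x} x≢x′ = trans (cong₂ _+_ (δ-≡ {i = x} refl) (δ-≢ x≢x′)) (+-identityʳ 1ℚ)

  δ-pair-opposite-self : ∀ {x : Fin n} → x ≢ opposite x → δ-pair x (opposite x) ≡ 1ℚ
  δ-pair-opposite-self {x = x} x≢x′ =
    trans (cong₂ _+_ (δ-≢ x≢x′) (δ-≡ {i = x} (sym (Fin.opposite-involutive x)))) (+-identityˡ 1ℚ)

  δ-pair-outside : ∀ {x j : Fin n} → j ≢ x → j ≢ opposite x → δ-pair x j ≡ 0ℚ
  δ-pair-outside {x = x} {j} j≢x j≢x′ = cong₂ _+_ (δ-≢ {i = x} (j≢x ∘ sym)) (δ-≢ {i = x} x≢j′)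
    where
    x≢j′ : x ≢ opposite j
    x≢j′ x≡j′ = j≢x′ (trans (sym (Fin.opposite-involutive j)) (cong opposite (sym x≡j′)))

  δ-pair-fixed : ∀ {c : Fin n} → opposite c ≡ c → δ-pair c c ≡ 1ℚ + 1ℚ
  δ-pair-fixed {c = c} c′≡c = cong₂ _+_ (δ-≡ {i = c} refl) (δ-≡ {i = c} (sym c′≡c))

  symmetrize-permutationMatrix-fixedRow : ∀ (π : Permutation′ n) {c} → opposite c ≡ c → ∀ j →
    symmetrize (permutationMatrix π) c j ≡ ¼ * (δ-pair (π ⟨$⟩ʳ c) j + δ-pair (π ⟨$⟩ˡ c) j)
  symmetrize-permutationMatrix-fixedRow π {c} c′≡c j rewrite c′≡c | δ-permute π j c | δ-permute π (opposite j) c =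
    solve 4 (λ a b c d → con ¼ :* (((a :+ b) :+ c) :+ d) := con ¼ :* ((a :+ d) :+ (b :+ c))) refl
      (δ (π ⟨$⟩ʳ c) j) (δ (π ⟨$⟩ˡ c) j) (δ (π ⟨$⟩ˡ c) (opposite j)) (δ (π ⟨$⟩ʳ c) (opposite j))

  -- In the 0-based Fin (2m+1), mid m is the paper's index m+1, and toℕ k < m says 1 ≤ k ≤ m.
  MiddleRow : ∀ m → Matrix (suc (m ℕ.+ m)) → (k l : Fin (suc (m ℕ.+ m))) → Set
  MiddleRow m A k l = ∀ j → A (mid m) j ≡ ¼ * (δ-pair k j + δ-pair l j)

  module _ {m : ℕ} where

    private
      M : Fin (suc (m ℕ.+ m))
      M = mid m

    toℕ-mid : toℕ M ≡ m
    toℕ-mid = Fin.toℕ-fromℕ< _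

    opposite-mid : opposite M ≡ M
    opposite-mid = Fin.toℕ-injective (begin
      toℕ (opposite M) ≡⟨ Fin.opposite-prop M ⟩
      m ℕ.+ m ∸ toℕ M  ≡⟨ cong (m ℕ.+ m ∸_) toℕ-mid ⟩
      m ℕ.+ m ∸ m      ≡⟨ ℕ.m+n∸m≡n m m ⟩
      m                ≡⟨ toℕ-mid ⟨
      toℕ M            ∎)
      where open ≡-Reasoning

    lowerHalf⇒upperHalf : ∀ {k : Fin (suc (m ℕ.+ m))} → toℕ k ℕ.< m → m ℕ.< toℕ (opposite k)
    lowerHalf⇒upperHalf {k} k<m = subst (m ℕ.<_) (sym toℕ-k′) (ℕ.m<m+n m (ℕ.m<n⇒0<n∸m k<m))
      where
      toℕ-k′ : toℕ (opposite k) ≡ m ℕ.+ (m ∸ toℕ k)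
      toℕ-k′ = trans (Fin.opposite-prop k) (ℕ.+-∸-assoc m (ℕ.<⇒≤ k<m))

    lowerHalf-≢-opposite : ∀ {k l : Fin (suc (m ℕ.+ m))} → toℕ k ℕ.< m → toℕ l ℕ.< m → k ≢ opposite l
    lowerHalf-≢-opposite k<m l<m k≡l′ =
      ℕ.<-asym k<m (subst (m ℕ.<_) (cong toℕ (sym k≡l′)) (lowerHalf⇒upperHalf l<m))

    ≢mid⇒lowerHalf : ∀ {j : Fin (suc (m ℕ.+ m))} → j ≢ M → toℕ j ℕ.< m ⊎ toℕ (opposite j) ℕ.< m
    ≢mid⇒lowerHalf {j} j≢M with ℕ.<-cmp (toℕ j) m
    ... | tri< j<m _ _ = inj₁ j<m
    ... | tri≈ _ j≡m _ = contradiction (Fin.toℕ-injective (trans j≡m (sym toℕ-mid))) j≢M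
    ... | tri> _ _ m<j = inj₂ (begin-strict
      toℕ (opposite j) ≡⟨ Fin.opposite-prop j ⟩
      m ℕ.+ m ∸ toℕ j  <⟨ ℕ.∸-monoʳ-< m<j (ℕ.≤-pred (Fin.toℕ<n j)) ⟩
      m ℕ.+ m ∸ m      ≡⟨ ℕ.m+n∸m≡n m m ⟩
      m                ∎)
      where open ℕ.≤-Reasoning

    lowerRepresentative : ∀ {x : Fin (suc (m ℕ.+ m))} → x ≢ M →
      Σ (Fin (suc (m ℕ.+ m))) λ k → toℕ k ℕ.< m × ∀ j → δ-pair x j ≡ δ-pair k j
    lowerRepresentative {x} x≢M with ≢mid⇒lowerHalf x≢M
    ... | inj₁ x<m  = x , x<m , λ j → refl
    ... | inj₂ x′<m = opposite x , x′<m , λ j → sym (δ-pair-opposite x j)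

    permutation-moves-mid : ∀ {A} (π : Permutation′ (suc (m ℕ.+ m))) →
      MiddleRow m A (π ⟨$⟩ʳ M) (π ⟨$⟩ˡ M) → A M M ≡ 0ℚ → π ⟨$⟩ʳ M ≢ M
    permutation-moves-mid {A} π row Aₘₘ≡0 πM≡M = contradiction (begin
      1ℚ                                              ≡⟨ cong (λ t → ¼ * (t + t)) (δ-pair-fixed opposite-mid) ⟨
      ¼ * (δ-pair M M + δ-pair M M)                   ≡⟨ cong₂ (λ x y → ¼ * (δ-pair x M + δ-pair y M)) πM≡M π⁻¹M≡M ⟨
      ¼ * (δ-pair (π ⟨$⟩ʳ M) M + δ-pair (π ⟨$⟩ˡ M) M) ≡⟨ row M ⟨
      A M M                                           ≡⟨ Aₘₘ≡0 ⟩
      0ℚ                                              ∎) λ ()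
      where
      open ≡-Reasoning
      π⁻¹M≡M = trans (cong (π ⟨$⟩ˡ_) (sym πM≡M)) (inverseˡ π)

    symmetrizedPermutation-middleRow : ∀ {A} (π : Permutation′ (suc (m ℕ.+ m))) →
      A ≋ symmetrize (permutationMatrix π) → A M M ≡ 0ℚ →
      Σ (Fin (suc (m ℕ.+ m))) λ k → Σ (Fin (suc (m ℕ.+ m))) λ l →
        toℕ k ℕ.< m × toℕ l ℕ.< m × MiddleRow m A k l
    symmetrizedPermutation-middleRow {A} π A≋B Aₘₘ≡0 =
      let k , k<m , πM≈k   = lowerRepresentative πM≢M
          l , l<m , π⁻¹M≈l = lowerRepresentative π⁻¹M≢M
      in k , l , k<m , l<m , λ j → trans (row j) (cong₂ (λ a b → ¼ * (a + b)) (πM≈k j) (π⁻¹M≈l j))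
      where
      row : MiddleRow m A (π ⟨$⟩ʳ M) (π ⟨$⟩ˡ M)
      row j = trans (A≋B M j) (symmetrize-permutationMatrix-fixedRow π opposite-mid j)
      πM≢M : π ⟨$⟩ʳ M ≢ M
      πM≢M = permutation-moves-mid {A = A} π row Aₘₘ≡0
      π⁻¹M≢M : π ⟨$⟩ˡ M ≢ M
      π⁻¹M≢M π⁻¹M≡M = πM≢M (trans (cong (π ⟨$⟩ʳ_) (sym π⁻¹M≡M)) (inverseʳ π))

  MiddleCrossHalves : (m : ℕ) → Matrix (suc (m ℕ.+ m)) → Set
  MiddleCrossHalves m A =
    Σ (Fin (suc (m ℕ.+ m))) λ k → toℕ k ℕ.< m ×
      A k (mid m) ≡ ½ × A (mid m) k ≡ ½ ×
      A (mid m) (opposite k) ≡ ½ × A (opposite k) (mid m) ≡ ½ ×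
      (∀ j → j ≢ k → j ≢ opposite k →
         A (mid m) j ≡ 0ℚ × A j (mid m) ≡ 0ℚ)

  MiddleCrossQuarters : (m : ℕ) → Matrix (suc (m ℕ.+ m)) → Set
  MiddleCrossQuarters m A =
    Σ (Fin (suc (m ℕ.+ m))) λ k → Σ (Fin (suc (m ℕ.+ m))) λ l →
      toℕ k ℕ.< toℕ l × toℕ l ℕ.< m ×
      A k (mid m) ≡ ¼ × A (mid m) k ≡ ¼ ×
      A (mid m) (opposite k) ≡ ¼ × A (opposite k) (mid m) ≡ ¼ ×
      A l (mid m) ≡ ¼ × A (mid m) l ≡ ¼ ×
      A (mid m) (opposite l) ≡ ¼ × A (opposite l) (mid m) ≡ ¼ ×
      (∀ j → j ≢ k → j ≢ opposite k → j ≢ l → j ≢ opposite l →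
         A (mid m) j ≡ 0ℚ × A j (mid m) ≡ 0ℚ)

  module MiddleCross (m : ℕ) (A : Matrix (suc (m ℕ.+ m))) (column≡row : ∀ j → A j (mid m) ≡ A (mid m) j) where

    private
      M : Fin (suc (m ℕ.+ m))
      M = mid m

    halves : ∀ {k} → toℕ k ℕ.< m → MiddleRow m A k k → MiddleCrossHalves m A
    halves {k} k<m row = k , k<m , trans (column≡row k) Aₘₖ , Aₘₖ , Aₘₖ′ , trans (column≡row _) Aₘₖ′ , zeros
      where
      k≢k′ = lowerHalf-≢-opposite k<m k<m
      entry : ∀ {j} a → δ-pair k j ≡ a → A M j ≡ ¼ * (a + a)
      entry {j} a kj≡a = trans (row j) (cong (λ t → ¼ * (t + t)) kj≡a)
      Aₘₖ : A M k ≡ ½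
      Aₘₖ = entry 1ℚ (δ-pair-self k≢k′)
      Aₘₖ′ : A M (opposite k) ≡ ½
      Aₘₖ′ = entry 1ℚ (δ-pair-opposite-self k≢k′)
      zeros : ∀ j → j ≢ k → j ≢ opposite k → A M j ≡ 0ℚ × A j M ≡ 0ℚ
      zeros j j≢k j≢k′ = Aₘⱼ , trans (column≡row j) Aₘⱼ
        where Aₘⱼ = entry 0ℚ (δ-pair-outside j≢k j≢k′)

    quarters : ∀ {k l} → toℕ k ℕ.< toℕ l → toℕ l ℕ.< m → MiddleRow m A k l → MiddleCrossQuarters m A
    quarters {k} {l} k<l l<m row =
      k , l , k<l , l<m ,
      trans (column≡row k) Aₘₖ , Aₘₖ , Aₘₖ′ , trans (column≡row _) Aₘₖ′ ,
      trans (column≡row l) Aₘₗ , Aₘₗ , Aₘₗ′ , trans (column≡row _) Aₘₗ′ , zeros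
      where
      k<m = ℕ.<-trans k<l l<m
      k≢k′ = lowerHalf-≢-opposite k<m k<m
      l≢l′ = lowerHalf-≢-opposite l<m l<m
      k≢l′ = lowerHalf-≢-opposite k<m l<m
      l≢k′ = lowerHalf-≢-opposite l<m k<m
      k≢l : k ≢ l
      k≢l k≡l = ℕ.<-irrefl (cong toℕ k≡l) k<l
      entry : ∀ {j} a b → δ-pair k j ≡ a → δ-pair l j ≡ b → A M j ≡ ¼ * (a + b)
      entry {j} a b kj≡a lj≡b = trans (row j) (cong₂ (λ a b → ¼ * (a + b)) kj≡a lj≡b)
      Aₘₖ : A M k ≡ ¼
      Aₘₖ = entry 1ℚ 0ℚ (δ-pair-self k≢k′) (δ-pair-outside k≢l k≢l′)
      Aₘₖ′ : A M (opposite k) ≡ ¼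
      Aₘₖ′ = entry 1ℚ 0ℚ (δ-pair-opposite-self k≢k′) (δ-pair-outside (l≢k′ ∘ sym) (k≢l ∘ opposite-injective))
      Aₘₗ : A M l ≡ ¼
      Aₘₗ = entry 0ℚ 1ℚ (δ-pair-outside (k≢l ∘ sym) l≢k′) (δ-pair-self l≢l′)
      Aₘₗ′ : A M (opposite l) ≡ ¼
      Aₘₗ′ = entry 0ℚ 1ℚ (δ-pair-outside (k≢l′ ∘ sym) (k≢l ∘ sym ∘ opposite-injective)) (δ-pair-opposite-self l≢l′)
      zeros : ∀ j → j ≢ k → j ≢ opposite k → j ≢ l → j ≢ opposite l → A M j ≡ 0ℚ × A j M ≡ 0ℚ
      zeros j j≢k j≢k′ j≢l j≢l′ = Aₘⱼ , trans (column≡row j) Aₘⱼ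
        where Aₘⱼ = entry 0ℚ 0ℚ (δ-pair-outside j≢k j≢k′) (δ-pair-outside j≢l j≢l′)

    classify : ∀ {k l} → toℕ k ℕ.< m → toℕ l ℕ.< m → MiddleRow m A k l →
      MiddleCrossHalves m A ⊎ MiddleCrossQuarters m A
    classify {k} {l} k<m l<m row with ℕ.<-cmp (toℕ k) (toℕ l)
    ... | tri< k<l _ _ = inj₂ (quarters k<l l<m row)
    ... | tri≈ _ k≡l _ rewrite Fin.toℕ-injective k≡l = inj₁ (halves l<m row)
    ... | tri> _ _ l<k = inj₂ (quarters l<k k<m λ j → trans (row j) (cong (¼ *_) (+-comm (δ-pair k j) (δ-pair l j))))

open ExtremePoints using (extreme⇒symmetrizedPermutation; symmetrizedPermutation-middleRow; module MiddleCross)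
open import Data.Nat using (ℕ; suc; _+_) renaming (_<_ to _<ℕ_)
open import Data.Fin using (Fin; toℕ; opposite)
open import Data.Rational using (0ℚ; ½)
open import Data.Product using (Σ; _×_; _,_; proj₁; proj₂)
open import Data.Sum using (_⊎_)
open import Relation.Binary.PropositionalEquality using (_≡_; _≢_)

lemma3p14 : (m : ℕ) (A : Matrix (suc (m + m))) →
  IsExtreme InΩth A → A (mid m) (mid m) ≡ 0ℚ →
  (Σ (Fin (suc (m + m))) λ k → toℕ k <ℕ m ×
      A k (mid m) ≡ ½ × A (mid m) k ≡ ½ ×
      A (mid m) (opposite k) ≡ ½ × A (opposite k) (mid m) ≡ ½ ×
      (∀ j → j ≢ k → j ≢ opposite k →
         A (mid m) j ≡ 0ℚ × A j (mid m) ≡ 0ℚ))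
  ⊎
  (Σ (Fin (suc (m + m))) λ k → Σ (Fin (suc (m + m))) λ l →
      toℕ k <ℕ toℕ l × toℕ l <ℕ m ×
      A k (mid m) ≡ ¼ × A (mid m) k ≡ ¼ ×
      A (mid m) (opposite k) ≡ ¼ × A (opposite k) (mid m) ≡ ¼ ×
      A l (mid m) ≡ ¼ × A (mid m) l ≡ ¼ ×
      A (mid m) (opposite l) ≡ ¼ × A (opposite l) (mid m) ≡ ¼ ×
      (∀ j → j ≢ k → j ≢ opposite k → j ≢ l → j ≢ opposite l →
         A (mid m) j ≡ 0ℚ × A j (mid m) ≡ 0ℚ))
lemma3p14 m A extreme Aₘₘ≡0 =
  let π , A≋B                 = extreme⇒symmetrizedPermutation {A = A} extreme
      k , l , k<m , l<m , row = symmetrizedPermutation-middleRow {m} {A} π A≋B Aₘₘ≡0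
      symmetric               = proj₁ (proj₂ (proj₁ extreme))
  in MiddleCross.classify m A (symmetric (mid m)) {k} {l} k<m l<m row
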